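{- Let $n\ge 3$. For $m\ge 2$ order the $2$-subsets $\{s,t\}$, $s<t$, of $\{1,\dots,m\}$ lexicographically and use them to index the coordinates of $\mathbb{F}_q^{\binom m2}$; thus the first $n-1$ coordinates of $\mathbb{F}_q^{\binom n2}$ are indexed by $\{1,2\},\dots,\{1,n\}$ and the remaining $\binom{n-1}{2}$ by the $2$-subsets of $\{2,\dots,n\}$, which we identify with the $2$-subsets of $\{1,\dots,n-1\}$ via $i\mapsto i-1$, so that $\mathbb{F}_q^{\binom n2}=\mathbb{F}_q^{n-1}\times\mathbb{F}_q^{\binom{n-1}{2}}$. For $v,u\in\mathbb{F}_q^m$ let $X_{v,u}\in\mathbb{F}_q^{\binom m2}$ have $\{s,t\}$-coordinate $v_su_t-v_tu_s$. For a $2$-subspace $U$ of $\mathbb{F}_q^m$ with basis $u,w$ let $P(U)=\langle X_{u,w}\rangle$, and for a $1$-subspace $V$ of $\mathbb{F}_q^m$ let $P_V=\bigcup_{U}P(U)$, the union over all $2$-subspaces $U\supseteq V$. Let $\mathbb{C}_n=\{P_V : V\in\mathcal{G}_q(n,1)\}$. Define $\mathbb{D}\subseteq\mathcal{P}(\mathbb{F}_q^{\binom n2})$ to consist of: $U_0=\{(x,\mathbf{0}):x\in\mathbb{F}_q^{n-1}\}$; for every nonzero $\hat v\in\mathbb{F}_q^{n-1}$, the subspace $U_{\hat v,0}=\langle\{(\hat v,\mathbf{0})\}\cup\{(\mathbf{0},w):w\in P_{\langle\hat v\rangle}\}\rangle$; and for every nonzero $\hat v\in\mathbb{F}_q^{n-1}$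 and nonzero $a\in\mathbb{F}_q$, the row span $U_{\hat v,a}$ of the $(n-1)\times\binom n2$ matrix whose $i$-th row is $(\hat e_i,\,a X_{\hat v,\hat e_i})$, $i=1,\dots,n-1$, where $\hat e_i$ is the $i$-th unit vector of $\mathbb{F}_q^{n-1}$. Then $\mathbb{D}=\mathbb{C}_n$.
   Context: $\mathcal{G}_q(m,k)$ is the set of $k$-dimensional subspaces of $\mathbb{F}_q^m$; $\langle S\rangle$ is the linear span; $\mathcal{P}(\cdot)$ denotes the set of subspaces. $P(U)$ is the (projective) Plücker embedding of the $2$-subspace $U$, viewed as a $1$-subspace of $\mathbb{F}_q^{\binom m2}$; it does not depend on the chosen basis. -}

module Defs where

open import Level using (0ℓ)
open import Data.Nat as ℕ using (ℕ; zero; suc; s≤s)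
open import Data.Fin as Fin using (Fin; zero; suc)
open import Data.Product using (Σ; ∃; ∃-syntax; _×_; _,_)
open import Data.Sum using (_⊎_)
open import Data.List using (List; []; _∷_)
open import Data.List.Membership.Propositional using (_∈_)
open import Data.List.Relation.Unary.All using (All)
open import Relation.Nullary using (¬_; Dec; does)
open import Relation.Binary.PropositionalEquality using (_≡_; _≢_)
open import Data.Bool using (if_then_else_)
open import Function.Bundles using (_⇔_)
open import Algebra.Structures using (IsCommutativeRing)

record FiniteField : Set₁ where
  infixl 6 _+_
  infixl 7 _*_
  field
    Carrier : Set
    _+_ _*_ : Carrier → Carrier → Carrier
    -_ : Carrier → Carrier
    0# 1# : Carrier
    isCommutativeRing : IsCommutativeRing _≡_ _+_ _*_ -_ 0# 1#
    0≢1 : 0# ≢ 1#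
    inverse : ∀ x → x ≢ 0# → ∃[ y ] (x * y ≡ 1#)
    _≟_ : (x y : Carrier) → Dec (x ≡ y)
    elements : List Carrier
    complete : ∀ x → x ∈ elements

-- Coordinate index set of F_q^{binom m 2}: the 2-subsets {s,t}, s<t, of Fin m.
Pair : ℕ → Set
Pair m = Σ (Fin m) λ s → Σ (Fin m) λ t → s Fin.< t

module _ (F : FiniteField) where
  open FiniteField F

  _-_ : Carrier → Carrier → Carrier
  x - y = x + (- y)

  Vec : Set → Set
  Vec I = I → Carrier

  Subset : Set → Set₁
  Subset I = Vec I → Set

  0v : ∀ {I} → Vec I
  0v _ = 0#

  _⊕_ : ∀ {I} → Vec I → Vec I → Vec I
  (u ⊕ v) i = u i + v i

  _•_ : ∀ {I} → Carrier → Vec I → Vec I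
  (a • v) i = a * v i

  _≋_ : ∀ {I} → Vec I → Vec I → Set
  u ≋ v = ∀ i → u i ≡ v i

  NonZero : ∀ {I} → Vec I → Set
  NonZero v = ¬ (v ≋ 0v)

  _≐_ : ∀ {I} → Subset I → Subset I → Set
  A ≐ B = ∀ x → (A x ⇔ B x)

  lincomb : ∀ {I} → List (Carrier × Vec I) → Vec I
  lincomb [] = 0v
  lincomb ((a , v) ∷ cs) = (a • v) ⊕ lincomb cs

  Span : ∀ {I} → Subset I → Subset I
  Span S x = ∃[ cs ] (All (λ c → S (Data.Product.proj₂ c)) cs × (x ≋ lincomb cs))

  e : ∀ {m} → Fin m → Vec (Fin m)
  e i j = if does (i Fin.≟ j) then 1# else 0#

  X : ∀ {m} → Vec (Fin m) → Vec (Fin m) → Vec (Pair m)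
  X v u (s , t , _) = (v s * u t) - (v t * u s)

  LinIndep₂ : ∀ {I} → Vec I → Vec I → Set
  LinIndep₂ u w = ∀ a b → ((a • u) ⊕ (b • w)) ≋ 0v → (a ≡ 0# × b ≡ 0#)

  -- P_V for V = ⟨v⟩: the union of P(U) = ⟨X_{u,w}⟩ over all 2-subspaces
  -- U = ⟨u,w⟩ containing V.
  P : ∀ {m} → Vec (Fin m) → Subset (Pair m)
  P v x = ∃[ u ] ∃[ w ] (LinIndep₂ u w
            × Span (λ y → y ≋ u ⊎ y ≋ w) v
            × Span (λ y → y ≋ X u w) x)

  -- identification F^{binom (k+1) 2} = F^k × F^{binom k 2}
  -- (coordinates {1,j+1} ↦ x_j, {s+1,t+1} ↦ y_{s,t})
  join : ∀ {k} → Vec (Fin k) → Vec (Pair k) → Vec (Pair (suc k))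
  join x y (zero , zero , ())
  join x y (zero , suc j , _) = x j
  join x y (suc s , zero , ())
  join x y (suc s , suc t , s≤s p) = y (s , t , p)

  -- the members of 𝔻 (paper's n = suc k)
  U₀ : ∀ {k} → Subset (Pair (suc k))
  U₀ z = ∃[ x ] (z ≋ join x 0v)

  U-0 : ∀ {k} → Vec (Fin k) → Subset (Pair (suc k))
  U-0 v̂ = Span (λ z → z ≋ join v̂ 0v ⊎ ∃[ w ] (P v̂ w × z ≋ join 0v w))

  U-a : ∀ {k} → Vec (Fin k) → Carrier → Subset (Pair (suc k))
  U-a v̂ a = Span (λ z → ∃[ i ] (z ≋ join (e i) (a • X v̂ (e i))))

  In𝔻 : ∀ {k} → Subset (Pair (suc k)) → Set
  In𝔻 S = (S ≐ U₀)
        ⊎ (∃[ v̂ ] (NonZero v̂ × S ≐ U-0 v̂))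
        ⊎ (∃[ v̂ ] ∃[ a ] (NonZero v̂ × a ≢ 0# × S ≐ U-a v̂ a))

  -- S ∈ ℂ_n = { P_V : V ∈ G_q(n,1) },  V = ⟨v⟩ with v ≠ 0
  Inℂ : ∀ {n} → Subset (Pair n) → Set
  Inℂ S = ∃[ v ] (NonZero v × S ≐ P v)

-- For v ≠ 0 in F^m with m ≥ 2, P_⟨v⟩ is the image of the linear map u ↦ X_{v,u}: every
-- 2-space through v is ⟨v, u⟩ for some u, and X is bilinear and alternating.  Writing
-- v = (v₀, v̂) and u = (u₀, û), one has X_{v,u} = (v₀û − u₀v̂, X_{v̂,û}) in
-- F^{n-1} × F^{binom (n-1) 2}.  If v₀ = 0 this image is spanned by (v̂, 0) and the vectors
-- (0, X_{v̂,û}), which make up (0, P_⟨v̂⟩); so it is U_{v̂,0}.  If v₀ ≠ 0 then, with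
-- x = v₀û − u₀v̂, the second component is v₀⁻¹X_{v̂,x}, so the image is the graph of
-- x ↦ v₀⁻¹X_{v̂,x}: this is U₀ when v̂ = 0 and U_{v̂,v₀⁻¹} otherwise.  Each member of 𝔻
-- arises from such a v, with v₀ = 1, 0 or a⁻¹.

module Submission where

open import Level using (0ℓ)
open import Algebra.Bundles using (CommutativeRing)
open import Algebra.Structures using (IsCommutativeRing)
open import Algebra.Solver.Ring.AlmostCommutativeRing using (fromCommutativeRing; _-Raw-AlmostCommutative⟶_)
open import Data.Bool using (if_then_else_)
open import Data.Nat as ℕ using (ℕ; zero; suc; _≤_; s≤s; z≤n)
import Data.Nat.Properties as ℕₚ
open import Data.Integer as ℤ using (ℤ; 0ℤ; 1ℤ)
import Data.Integer.Properties as ℤₚ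
open import Data.Maybe using (Maybe; just; nothing)
open import Data.Fin as Fin using (Fin; zero; suc; punchIn)
open import Data.Fin.Properties using (all?; ¬∀⟶∃¬; punchInᵢ≢i)
open import Data.Vec.Functional using (head; tail) renaming (_∷_ to _∷ᵛ_)
open import Data.List using (List; []; _∷_; map; tabulate)
open import Data.List.Relation.Unary.All using (All; []; _∷_)
open import Data.List.Relation.Unary.All.Properties using (map⁺; tabulate⁺)
open import Data.Product using (∃-syntax; _×_; _,_; proj₂; map₂)
open import Data.Sum using (_⊎_; inj₁; inj₂)
open import Data.Empty using (⊥-elim)
open import Relation.Nullary using (Dec; yes; no)
open import Relation.Nullary.Decidable using (dec-true; dec-false)
open import Relation.Unary using (_⊆_)
open import Relation.Binary.PropositionalEquality
  using (_≡_; _≢_; refl; sym; trans; cong; cong₂; module ≡-Reasoning)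
open import Relation.Binary.Structures using (IsEquivalence)
open import Function.Base using (id; _∘_)
open import Function.Bundles using (_⇔_; mk⇔; Equivalence)
open import Function.Properties.Equivalence using (⇔-isEquivalence)
open import Defs using (FiniteField; Pair; Subset; In𝔻; Inℂ)
import Defs

-- The ring solver needs computable coefficients, so it works over ℤ
-- through the canonical ring morphism ℤ → A.
module IntegerRingSolver
  {A : Set} {_+ᴬ_ _*ᴬ_ : A → A → A} { -ᴬ_ : A → A } {0ᴬ 1ᴬ : A}
  (isCommutativeRing : IsCommutativeRing _≡_ _+ᴬ_ _*ᴬ_ -ᴬ_ 0ᴬ 1ᴬ) where

  open ≡-Reasoning

  commutativeRing : CommutativeRing 0ℓ 0ℓ
  commutativeRing = record { isCommutativeRing = isCommutativeRing }

  open CommutativeRing commutativeRing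
    using ( Carrier; _+_; _*_; -_; 0#; 1#; +-comm; +-identityˡ; +-identityʳ; -‿inverseʳ
          ; ring; semiring; +-commutativeSemigroup)
  open import Algebra.Properties.Ring ring using (-‿involutive; -0#≈0#; -‿+-comm; -‿distribˡ-*; -‿distribʳ-*)
  open import Algebra.Properties.CommutativeSemigroup +-commutativeSemigroup using (interchange)
  open import Algebra.Properties.Semiring.Mult.TCOptimised semiring using (1+×; ×-homo-+; ×1-homo-*)
    renaming (_×_ to _×ₙ_)

  fromℤ : ℤ → Carrier
  fromℤ (ℤ.+ n)    = n ×ₙ 1#
  fromℤ ℤ.-[1+ n ] = - (suc n ×ₙ 1#)

  fromℤ-neg : ∀ i → fromℤ (ℤ.- i) ≡ - fromℤ i
  fromℤ-neg (ℤ.+ zero)  = sym -0#≈0#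
  fromℤ-neg (ℤ.+ suc n) = refl
  fromℤ-neg ℤ.-[1+ n ]  = sym (-‿involutive _)

  fromℤ-⊖ : ∀ m n → fromℤ (m ℤ.⊖ n) ≡ m ×ₙ 1# + - (n ×ₙ 1#)
  fromℤ-⊖ zero    zero    = sym (trans (cong (0# +_) -0#≈0#) (+-identityʳ 0#))
  fromℤ-⊖ zero    (suc n) = sym (+-identityˡ _)
  fromℤ-⊖ (suc m) zero    = sym (trans (cong (suc m ×ₙ 1# +_) -0#≈0#) (+-identityʳ _))
  fromℤ-⊖ (suc m) (suc n) = begin
    fromℤ (suc m ℤ.⊖ suc n)                  ≡⟨ cong fromℤ (ℤₚ.[1+m]⊖[1+n]≡m⊖n m n) ⟩
    fromℤ (m ℤ.⊖ n)                          ≡⟨ fromℤ-⊖ m n ⟩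
    m ×ₙ 1# + - (n ×ₙ 1#)                    ≡⟨ sym (+-identityˡ _) ⟩
    0# + (m ×ₙ 1# + - (n ×ₙ 1#))             ≡⟨ cong (_+ (m ×ₙ 1# + - (n ×ₙ 1#))) (sym (-‿inverseʳ 1#)) ⟩
    (1# + - 1#) + (m ×ₙ 1# + - (n ×ₙ 1#))    ≡⟨ interchange 1# (- 1#) (m ×ₙ 1#) (- (n ×ₙ 1#)) ⟩
    (1# + m ×ₙ 1#) + (- 1# + - (n ×ₙ 1#))    ≡⟨ cong₂ _+_ (sym (1+× m 1#)) (-‿+-comm 1# (n ×ₙ 1#)) ⟩
    suc m ×ₙ 1# + - (1# + n ×ₙ 1#)           ≡⟨ cong (λ a → suc m ×ₙ 1# + - a) (sym (1+× n 1#)) ⟩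
    suc m ×ₙ 1# + - (suc n ×ₙ 1#)            ∎

  fromℤ-+ : ∀ i j → fromℤ (i ℤ.+ j) ≡ fromℤ i + fromℤ j
  fromℤ-+ (ℤ.+ m)    (ℤ.+ n)    = ×-homo-+ 1# m n
  fromℤ-+ (ℤ.+ m)    ℤ.-[1+ n ] = fromℤ-⊖ m (suc n)
  fromℤ-+ ℤ.-[1+ m ] (ℤ.+ n)    = trans (fromℤ-⊖ n (suc m)) (+-comm _ _)
  fromℤ-+ ℤ.-[1+ m ] ℤ.-[1+ n ] = begin
    - (suc (suc (m ℕ.+ n)) ×ₙ 1#) ≡⟨ cong (λ k → - (suc k ×ₙ 1#)) (sym (ℕₚ.+-suc m n)) ⟩
    - ((suc m ℕ.+ suc n) ×ₙ 1#)   ≡⟨ cong -_ (×-homo-+ 1# (suc m) (suc n)) ⟩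
    - (suc m ×ₙ 1# + suc n ×ₙ 1#) ≡⟨ sym (-‿+-comm _ _) ⟩
    - (suc m ×ₙ 1#) + - (suc n ×ₙ 1#) ∎

  fromℤ-*-pos : ∀ m j → fromℤ (ℤ.+ m ℤ.* j) ≡ fromℤ (ℤ.+ m) * fromℤ j
  fromℤ-*-pos m (ℤ.+ n)    = trans (cong fromℤ (sym (ℤₚ.pos-* m n))) (×1-homo-* m n)
  fromℤ-*-pos m ℤ.-[1+ n ] = begin
    fromℤ (ℤ.+ m ℤ.* ℤ.-[1+ n ])      ≡⟨ cong fromℤ (sym (ℤₚ.neg-distribʳ-* (ℤ.+ m) (ℤ.+ suc n))) ⟩
    fromℤ (ℤ.- (ℤ.+ m ℤ.* ℤ.+ suc n)) ≡⟨ fromℤ-neg (ℤ.+ m ℤ.* ℤ.+ suc n) ⟩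
    - fromℤ (ℤ.+ m ℤ.* ℤ.+ suc n)     ≡⟨ cong -_ (fromℤ-*-pos m (ℤ.+ suc n)) ⟩
    - (m ×ₙ 1# * suc n ×ₙ 1#)         ≡⟨ -‿distribʳ-* _ _ ⟩
    m ×ₙ 1# * - (suc n ×ₙ 1#)         ∎

  fromℤ-* : ∀ i j → fromℤ (i ℤ.* j) ≡ fromℤ i * fromℤ j
  fromℤ-* (ℤ.+ m)    j = fromℤ-*-pos m j
  fromℤ-* ℤ.-[1+ m ] j = begin
    fromℤ (ℤ.-[1+ m ] ℤ.* j)      ≡⟨ cong fromℤ (sym (ℤₚ.neg-distribˡ-* (ℤ.+ suc m) j)) ⟩
    fromℤ (ℤ.- (ℤ.+ suc m ℤ.* j)) ≡⟨ fromℤ-neg (ℤ.+ suc m ℤ.* j) ⟩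
    - fromℤ (ℤ.+ suc m ℤ.* j)     ≡⟨ cong -_ (fromℤ-*-pos (suc m) j) ⟩
    - (suc m ×ₙ 1# * fromℤ j)     ≡⟨ -‿distribˡ-* _ _ ⟩
    - (suc m ×ₙ 1#) * fromℤ j     ∎

  fromℤ-morphism : ℤ.+-*-rawRing -Raw-AlmostCommutative⟶ fromCommutativeRing commutativeRing
  fromℤ-morphism = record
    { ⟦_⟧ = fromℤ ; +-homo = fromℤ-+ ; *-homo = fromℤ-* ; -‿homo = fromℤ-neg ; 0-homo = refl ; 1-homo = refl }

  fromℤ-≟ : ∀ i j → Maybe (fromℤ i ≡ fromℤ j)
  fromℤ-≟ i j with i ℤ.≟ j
  ... | yes i≡j = just (cong fromℤ i≡j)
  ... | no _    = nothing

  open import Algebra.Solver.Ring ℤ.+-*-rawRing (fromCommutativeRing commutativeRing) fromℤ-morphism fromℤ-≟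
    public using (solve; _:=_; _:+_; _:*_; :-_; con)

module Plücker (F : FiniteField) where
  open FiniteField F
  open ≡-Reasoning
  open IntegerRingSolver isCommutativeRing using (commutativeRing; solve; _:=_; _:+_; _:*_; :-_; con)
  open CommutativeRing commutativeRing using (*-identityˡ; *-identityʳ; *-assoc; *-comm; zeroˡ; zeroʳ)

  infixl 6 _⊕_
  infixr 7 _•_
  infix 4 _≋_ _≐_

  Vec : Set → Set
  Vec = Defs.Vec F

  0v : ∀ {I} → Vec I
  0v = Defs.0v F

  _⊕_ : ∀ {I} → Vec I → Vec I → Vec I
  _⊕_ = Defs._⊕_ F

  _•_ : ∀ {I} → Carrier → Vec I → Vec I
  _•_ = Defs._•_ F

  _≋_ : ∀ {I} → Vec I → Vec I → Set
  _≋_ = Defs._≋_ F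

  _≐_ : ∀ {I} → Subset F I → Subset F I → Set
  _≐_ = Defs._≐_ F

  NonZero : ∀ {I} → Vec I → Set
  NonZero = Defs.NonZero F

  lincomb : ∀ {I} → List (Carrier × Vec I) → Vec I
  lincomb = Defs.lincomb F

  Span : ∀ {I} → Subset F I → Subset F I
  Span = Defs.Span F

  LinIndep₂ : ∀ {I} → Vec I → Vec I → Set
  LinIndep₂ = Defs.LinIndep₂ F

  e : ∀ {m} → Fin m → Vec (Fin m)
  e = Defs.e F

  X : ∀ {m} → Vec (Fin m) → Vec (Fin m) → Vec (Pair m)
  X = Defs.X F

  P : ∀ {m} → Vec (Fin m) → Subset F (Pair m)
  P = Defs.P F

  join : ∀ {k} → Vec (Fin k) → Vec (Pair k) → Vec (Pair (suc k))
  join = Defs.join F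

  U₀ : ∀ {k} → Subset F (Pair (suc k))
  U₀ = Defs.U₀ F

  U-0 : ∀ {k} → Vec (Fin k) → Subset F (Pair (suc k))
  U-0 = Defs.U-0 F

  U-a : ∀ {k} → Vec (Fin k) → Carrier → Subset F (Pair (suc k))
  U-a = Defs.U-a F

  x*y≡0⇒x≡0 : ∀ {x y} → y ≢ 0# → x * y ≡ 0# → x ≡ 0#
  x*y≡0⇒x≡0 {x} {y} y≢0 xy≡0 with inverse y y≢0
  ... | y⁻¹ , yy⁻¹≡1 = begin
    x              ≡⟨ sym (*-identityʳ x) ⟩
    x * 1#         ≡⟨ cong (x *_) (sym yy⁻¹≡1) ⟩
    x * (y * y⁻¹)  ≡⟨ sym (*-assoc x y y⁻¹) ⟩
    (x * y) * y⁻¹  ≡⟨ cong (_* y⁻¹) xy≡0 ⟩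
    0# * y⁻¹       ≡⟨ zeroˡ y⁻¹ ⟩
    0#             ∎

  cancel-inverse : ∀ {a b} → a * b ≡ 1# → ∀ x → a * (b * x) ≡ x
  cancel-inverse {a} {b} ab≡1 x = begin
    a * (b * x)  ≡⟨ sym (*-assoc a b x) ⟩
    (a * b) * x  ≡⟨ cong (_* x) ab≡1 ⟩
    1# * x       ≡⟨ *-identityˡ x ⟩
    x            ∎

  ≋-sym : ∀ {I} {x y : Vec I} → x ≋ y → y ≋ x
  ≋-sym x≋y i = sym (x≋y i)

  ≋-trans : ∀ {I} {x y z : Vec I} → x ≋ y → y ≋ z → x ≋ z
  ≋-trans x≋y y≋z i = trans (x≋y i) (y≋z i)

  ≐-sym : ∀ {I} {A B : Subset F I} → A ≐ B → B ≐ A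
  ≐-sym A≐B x = IsEquivalence.sym ⇔-isEquivalence (A≐B x)

  ≐-trans : ∀ {I} {A B C : Subset F I} → A ≐ B → B ≐ C → A ≐ C
  ≐-trans A≐B B≐C x = IsEquivalence.trans ⇔-isEquivalence (A≐B x) (B≐C x)

  e-diagonal : ∀ {m} (i : Fin m) → e i i ≡ 1#
  e-diagonal i = cong (λ b → if b then 1# else 0#) (dec-true (i Fin.≟ i) refl)

  e-off-diagonal : ∀ {m} {i j : Fin m} → i ≢ j → e i j ≡ 0#
  e-off-diagonal {i = i} {j} i≢j = cong (λ b → if b then 1# else 0#) (dec-false (i Fin.≟ j) i≢j)

  nonzero-coordinate : ∀ {m} {v : Vec (Fin m)} → NonZero v → ∃[ i ] (v i ≢ 0#)
  nonzero-coordinate {m} {v} v≢0 = ¬∀⟶∃¬ m (λ i → v i ≡ 0#) (λ i → v i ≟ 0#) v≢0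

  LinIndep₂-pivot : ∀ {I} {v w : Vec I} {i l : I} → v i ≢ 0# → w i ≡ 0# → w l ≢ 0# → LinIndep₂ v w
  LinIndep₂-pivot {v = v} {w} {i} {l} vᵢ≢0 wᵢ≡0 wₗ≢0 a b av+bw≡0 = a≡0 , b≡0
    where
    a≡0 : a ≡ 0#
    a≡0 = x*y≡0⇒x≡0 vᵢ≢0 (begin
      a * v i               ≡⟨ solve 3 (λ a vᵢ b → a :* vᵢ := a :* vᵢ :+ b :* con 0ℤ) refl a (v i) b ⟩
      a * v i + b * 0#      ≡⟨ cong (λ c → a * v i + b * c) (sym wᵢ≡0) ⟩
      a * v i + b * w i     ≡⟨ av+bw≡0 i ⟩
      0#                    ∎)
    b≡0 : b ≡ 0#
    b≡0 = x*y≡0⇒x≡0 wₗ≢0 (begin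
      b * w l               ≡⟨ solve 3 (λ vₗ b wₗ → b :* wₗ := con 0ℤ :* vₗ :+ b :* wₗ) refl (v l) b (w l) ⟩
      0# * v l + b * w l    ≡⟨ cong (λ c → c * v l + b * w l) (sym a≡0) ⟩
      a * v l + b * w l     ≡⟨ av+bw≡0 l ⟩
      0#                    ∎)

  S⊆Span : ∀ {I} {S : Subset F I} → S ⊆ Span S
  S⊆Span {x = x} x∈S = (1# , x) ∷ [] , x∈S ∷ [] , λ i → solve 1 (λ xᵢ → xᵢ := con 1ℤ :* xᵢ :+ con 0ℤ) refl (x i)

  record Linear {J I : Set} (f : Vec J → Vec I) : Set where
    field
      cong-≋ : ∀ {x y} → x ≋ y → f x ≋ f y
      map-0v : f 0v ≋ 0v
      map-comb : ∀ c x y → f ((c • x) ⊕ y) ≋ (c • f x) ⊕ f y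

  Image : ∀ {J I} → (Vec J → Vec I) → Subset F I
  Image f x = ∃[ u ] (x ≋ f u)

  Span⊆Image : ∀ {J I} {f : Vec J → Vec I} {S : Subset F I} →
               Linear f → S ⊆ Image f → Span S ⊆ Image f
  Span⊆Image {J} {I} {f} {S} lin S⊆Imf (cs , cs⊆S , x≋) with lincomb∈Image cs cs⊆S
    where
    open Linear lin
    lincomb∈Image : (cs : List (Carrier × Vec I)) → All (λ c → S (proj₂ c)) cs → Image f (lincomb cs)
    lincomb∈Image [] [] = 0v , ≋-sym map-0v
    lincomb∈Image ((c , y) ∷ cs) (y∈S ∷ cs⊆S) with S⊆Imf y∈S | lincomb∈Image cs cs⊆S
    ... | u , y≋fu | w , rest≋fw =
      (c • u) ⊕ w , λ i → trans (cong₂ _+_ (cong (c *_) (y≋fu i)) (rest≋fw i)) (sym (map-comb c u w i))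
  ... | u , lincomb≋fu = u , ≋-trans x≋ lincomb≋fu

  lincomb-map : ∀ {J I} {f : Vec J → Vec I} → Linear f →
                (cs : List (Carrier × Vec J)) → lincomb (map (map₂ f) cs) ≋ f (lincomb cs)
  lincomb-map lin [] = ≋-sym (Linear.map-0v lin)
  lincomb-map {f = f} lin ((c , y) ∷ cs) i =
    trans (cong (c * f y i +_) (lincomb-map lin cs i)) (sym (Linear.map-comb lin c y (lincomb cs) i))

  basis : ∀ {n} → Vec (Fin n) → List (Carrier × Vec (Fin n))
  basis x = tabulate (λ i → x i , e i)

  lincomb-shifted : ∀ {n m} (c : Vec (Fin n)) (f : Fin n → Fin m) →
                    lincomb (tabulate (λ i → c i , e (suc (f i)))) ≋ (0# ∷ᵛ lincomb (tabulate (λ i → c i , e (f i))))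
  lincomb-shifted {zero} c f zero    = refl
  lincomb-shifted {zero} c f (suc j) = refl
  lincomb-shifted {suc n}  c f zero    =
    trans (cong (c zero * 0# +_) (lincomb-shifted (tail c) (f ∘ suc) zero))
          (solve 1 (λ c₀ → c₀ :* con 0ℤ :+ con 0ℤ := con 0ℤ) refl (c zero))
  lincomb-shifted {suc n}  c f (suc j) =
    cong (c zero * e (f zero) j +_) (lincomb-shifted (tail c) (f ∘ suc) (suc j))

  lincomb-basis : ∀ {n} (x : Vec (Fin n)) → x ≋ lincomb (basis x)
  lincomb-basis {suc n} x zero = sym (begin
    x zero * 1# + lincomb (tabulate (λ i → x (suc i) , e (suc i))) zero
      ≡⟨ cong (x zero * 1# +_) (lincomb-shifted (tail x) id zero) ⟩
    x zero * 1# + 0#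
      ≡⟨ solve 1 (λ x₀ → x₀ :* con 1ℤ :+ con 0ℤ := x₀) refl (x zero) ⟩
    x zero ∎)
  lincomb-basis {suc n} x (suc j) = sym (begin
    x zero * 0# + lincomb (tabulate (λ i → x (suc i) , e (suc i))) (suc j)
      ≡⟨ cong (x zero * 0# +_) (lincomb-shifted (tail x) id (suc j)) ⟩
    x zero * 0# + lincomb (basis (tail x)) j
      ≡⟨ solve 2 (λ x₀ y → x₀ :* con 0ℤ :+ y := y) refl (x zero) _ ⟩
    lincomb (basis (tail x)) j
      ≡⟨ sym (lincomb-basis (tail x) j) ⟩
    x (suc j) ∎)

  Span-basis-image≐Image : ∀ {n I} {f : Vec (Fin n) → Vec I} → Linear f →
                           Span (λ z → ∃[ i ] (z ≋ f (e i))) ≐ Image f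
  Span-basis-image≐Image {f = f} lin z = mk⇔
    (Span⊆Image lin (λ (i , z≋) → e i , z≋))
    (λ (u , z≋fu) → map (map₂ f) (basis u) ,
                    map⁺ (tabulate⁺ (λ i → i , λ _ → refl)) ,
                    ≋-trans z≋fu (≋-trans (Linear.cong-≋ lin (lincomb-basis u)) (≋-sym (lincomb-map lin (basis u)))))

  id-linear : ∀ {I} → Linear {I} (λ x → x)
  id-linear = record { cong-≋ = λ x≋y → x≋y ; map-0v = λ _ → refl ; map-comb = λ _ _ _ _ → refl }

  •-linear : ∀ {J I} {f : Vec J → Vec I} (a : Carrier) → Linear f → Linear (λ x → a • f x)
  •-linear {f = f} a lin = record
    { cong-≋   = λ x≋y i → cong (a *_) (cong-≋ x≋y i)
    ; map-0v   = λ i → trans (cong (a *_) (map-0v i)) (zeroʳ a)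
    ; map-comb = λ c x y i → trans (cong (a *_) (map-comb c x y i))
        (solve 4 (λ a c p q → a :* (c :* p :+ q) := c :* (a :* p) :+ a :* q) refl a c (f x i) (f y i))
    }
    where open Linear lin

  X-cong : ∀ {m} {v v′ u u′ : Vec (Fin m)} → v ≋ v′ → u ≋ u′ → X v u ≋ X v′ u′
  X-cong v≋v′ u≋u′ (s , t , _) =
    cong₂ (λ a b → a + - b) (cong₂ _*_ (v≋v′ s) (u≋u′ t)) (cong₂ _*_ (v≋v′ t) (u≋u′ s))

  X-linear : ∀ {m} (v : Vec (Fin m)) → Linear (X v)
  X-linear v = record
    { cong-≋   = X-cong (λ _ → refl)
    ; map-0v   = λ { (s , t , _) →
        solve 2 (λ vₛ vₜ → vₛ :* con 0ℤ :+ :- (vₜ :* con 0ℤ) := con 0ℤ) refl (v s) (v t) }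
    ; map-comb = λ { c x y (s , t , _) →
        solve 7 (λ vₛ vₜ c xₛ xₜ yₛ yₜ →
                   vₛ :* (c :* xₜ :+ yₜ) :+ :- (vₜ :* (c :* xₛ :+ yₛ))
                := c :* (vₛ :* xₜ :+ :- (vₜ :* xₛ)) :+ (vₛ :* yₜ :+ :- (vₜ :* yₛ)))
          refl (v s) (v t) c (x s) (x t) (y s) (y t) }
    }

  X-•ʳ : ∀ {m} (v u : Vec (Fin m)) c → X v (c • u) ≋ c • X v u
  X-•ʳ v u c (s , t , _) =
    solve 5 (λ vₛ vₜ uₛ uₜ c → vₛ :* (c :* uₜ) :+ :- (vₜ :* (c :* uₛ)) := c :* (vₛ :* uₜ :+ :- (vₜ :* uₛ)))
      refl (v s) (v t) (u s) (u t) c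

  X-shift : ∀ {m} (v u : Vec (Fin m)) d → X v (u ⊕ (d • v)) ≋ X v u
  X-shift v u d (s , t , _) =
    solve 5 (λ vₛ vₜ uₛ uₜ d → vₛ :* (uₜ :+ d :* vₜ) :+ :- (vₜ :* (uₛ :+ d :* vₛ)) := vₛ :* uₜ :+ :- (vₜ :* uₛ))
      refl (v s) (v t) (u s) (u t) d

  X-comb-right : ∀ {m} (u w : Vec (Fin m)) α β c → X ((α • u) ⊕ (β • w)) (c • w) ≋ (α * c) • X u w
  X-comb-right u w α β c (s , t , _) =
    solve 7 (λ uₛ uₜ wₛ wₜ α β c →
               (α :* uₛ :+ β :* wₛ) :* (c :* wₜ) :+ :- ((α :* uₜ :+ β :* wₜ) :* (c :* wₛ))
            := (α :* c) :* (uₛ :* wₜ :+ :- (uₜ :* wₛ)))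
      refl (u s) (u t) (w s) (w t) α β c

  X-comb-left : ∀ {m} (u w : Vec (Fin m)) α β c → X ((α • u) ⊕ (β • w)) (c • u) ≋ (- (β * c)) • X u w
  X-comb-left u w α β c (s , t , _) =
    solve 7 (λ uₛ uₜ wₛ wₜ α β c →
               (α :* uₛ :+ β :* wₛ) :* (c :* uₜ) :+ :- ((α :* uₜ :+ β :* wₜ) :* (c :* uₛ))
            := (:- (β :* c)) :* (uₛ :* wₜ :+ :- (uₜ :* wₛ)))
      refl (u s) (u t) (w s) (w t) α β c

  X-zeroˡ : ∀ {m} {v u : Vec (Fin m)} → v ≋ 0v → X v u ≋ 0v
  X-zeroˡ {u = u} v≋0 p@(s , t , _) = trans (X-cong v≋0 (λ _ → refl) p)
    (solve 2 (λ uₛ uₜ → con 0ℤ :* uₜ :+ :- (con 0ℤ :* uₛ) := con 0ℤ) refl (u s) (u t))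

  comb₁ : ∀ {I} → Vec I → Vec (Fin 1) → Vec I
  comb₁ y c = c zero • y

  comb₁-linear : ∀ {I} (y : Vec I) → Linear (comb₁ y)
  comb₁-linear y = record
    { cong-≋   = λ c≋d i → cong (_* y i) (c≋d zero)
    ; map-0v   = λ i → zeroˡ (y i)
    ; map-comb = λ c x x′ i →
        solve 4 (λ c x x′ yᵢ → (c :* x :+ x′) :* yᵢ := c :* (x :* yᵢ) :+ x′ :* yᵢ) refl c (x zero) (x′ zero) (y i)
    }

  comb₂ : ∀ {I} → Vec I → Vec I → Vec (Fin 2) → Vec I
  comb₂ u w c = (c zero • u) ⊕ (c (suc zero) • w)

  comb₂-linear : ∀ {I} (u w : Vec I) → Linear (comb₂ u w)
  comb₂-linear u w = record
    { cong-≋   = λ c≋d i → cong₂ (λ α β → α * u i + β * w i) (c≋d zero) (c≋d (suc zero))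
    ; map-0v   = λ i → solve 2 (λ uᵢ wᵢ → con 0ℤ :* uᵢ :+ con 0ℤ :* wᵢ := con 0ℤ) refl (u i) (w i)
    ; map-comb = λ c x y i →
        solve 7 (λ c α β α′ β′ uᵢ wᵢ →
                   (c :* α :+ α′) :* uᵢ :+ (c :* β :+ β′) :* wᵢ
                := c :* (α :* uᵢ :+ β :* wᵢ) :+ (α′ :* uᵢ :+ β′ :* wᵢ))
          refl c (x zero) (x (suc zero)) (y zero) (y (suc zero)) (u i) (w i)
    }

  X-comb∈Image-X : ∀ {m} {u w v : Vec (Fin m)} α β γ → NonZero v → v ≋ (α • u) ⊕ (β • w) →
                   Image (X v) (γ • X u w)
  X-comb∈Image-X {u = u} {w} {v} α β γ v≢0 v≋ with α ≟ 0# | β ≟ 0#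
  ... | no α≢0 | _ with inverse α α≢0
  ...   | α⁻¹ , αα⁻¹≡1 = c • w , λ p → begin
    γ * X u w p                  ≡⟨ cong (_* X u w p) (sym (cancel-inverse αα⁻¹≡1 γ)) ⟩
    (α * c) * X u w p            ≡⟨ sym (X-comb-right u w α β c p) ⟩
    X ((α • u) ⊕ (β • w)) (c • w) p ≡⟨ sym (X-cong {u = c • w} v≋ (λ _ → refl) p) ⟩
    X v (c • w) p                ∎
    where c = α⁻¹ * γ
  X-comb∈Image-X {u = u} {w} {v} α β γ v≢0 v≋ | yes α≡0 | no β≢0 with inverse β β≢0
  ... | β⁻¹ , ββ⁻¹≡1 = c • u , λ p → begin
    γ * X u w p                  ≡⟨ cong (_* X u w p) (sym (cancel-inverse ββ⁻¹≡1 γ)) ⟩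
    (β * (β⁻¹ * γ)) * X u w p    ≡⟨ cong (_* X u w p) (solve 2 (λ β t → β :* t := :- (β :* :- t)) refl β (β⁻¹ * γ)) ⟩
    (- (β * c)) * X u w p        ≡⟨ sym (X-comb-left u w α β c p) ⟩
    X ((α • u) ⊕ (β • w)) (c • u) p ≡⟨ sym (X-cong {u = c • u} v≋ (λ _ → refl) p) ⟩
    X v (c • u) p                ∎
    where c = - (β⁻¹ * γ)
  X-comb∈Image-X {u = u} {w} {v} α β γ v≢0 v≋ | yes α≡0 | yes β≡0 = ⊥-elim (v≢0 λ i → begin
    v i                    ≡⟨ v≋ i ⟩
    α * u i + β * w i      ≡⟨ cong₂ (λ a b → a * u i + b * w i) α≡0 β≡0 ⟩
    0# * u i + 0# * w i    ≡⟨ solve 2 (λ uᵢ wᵢ → con 0ℤ :* uᵢ :+ con 0ℤ :* wᵢ := con 0ℤ) refl (u i) (w i) ⟩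
    0#                     ∎)

  P⊆Image-X : ∀ {m} {v : Vec (Fin m)} → NonZero v → P v ⊆ Image (X v)
  P⊆Image-X v≢0 (u , w , _ , v∈⟨u,w⟩ , x∈⟨Xuw⟩)
    with Span⊆Image (comb₂-linear u w) generators₂ v∈⟨u,w⟩ | Span⊆Image (comb₁-linear (X u w)) generators₁ x∈⟨Xuw⟩
    where
    generators₂ : (λ y → y ≋ u ⊎ y ≋ w) ⊆ Image (comb₂ u w)
    generators₂ (inj₁ y≋u) = e zero , λ i → trans (y≋u i)
      (solve 2 (λ uᵢ wᵢ → uᵢ := con 1ℤ :* uᵢ :+ con 0ℤ :* wᵢ) refl (u i) (w i))
    generators₂ (inj₂ y≋w) = e (suc zero) , λ i → trans (y≋w i)
      (solve 2 (λ uᵢ wᵢ → wᵢ := con 0ℤ :* uᵢ :+ con 1ℤ :* wᵢ) refl (u i) (w i))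
    generators₁ : (λ y → y ≋ X u w) ⊆ Image (comb₁ (X u w))
    generators₁ y≋ = e zero , λ p → trans (y≋ p) (sym (*-identityˡ _))
  ... | c , v≋ | d , x≋ with X-comb∈Image-X (c zero) (c (suc zero)) (d zero) v≢0 v≋
  ...   | z , dXuw≋Xvz = z , ≋-trans x≋ dXuw≋Xvz

  Image-X⊆P-pivot : ∀ {m} {v : Vec (Fin (suc (suc m)))} {i} → v i ≢ 0# → Image (X v) ⊆ P v
  Image-X⊆P-pivot {v = v} {i} vᵢ≢0 {x} (u , x≋Xvu) with inverse (v i) vᵢ≢0
  ... | vᵢ⁻¹ , vᵢvᵢ⁻¹≡1 = by-cases (all? (λ l → u′ l ≟ 0#))
    where
    -- subtracting a multiple of v clears the pivot coordinate and leaves X_{v,u} unchanged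
    u′ = u ⊕ ((- (u i * vᵢ⁻¹)) • v)
    u′ᵢ≡0 : u′ i ≡ 0#
    u′ᵢ≡0 = begin
      u i + - (u i * vᵢ⁻¹) * v i    ≡⟨ solve 3 (λ uᵢ vᵢ w → uᵢ :+ :- (uᵢ :* w) :* vᵢ := uᵢ :+ :- (uᵢ :* (vᵢ :* w)))
                                         refl (u i) (v i) vᵢ⁻¹ ⟩
      u i + - (u i * (v i * vᵢ⁻¹))  ≡⟨ cong (λ c → u i + - (u i * c)) vᵢvᵢ⁻¹≡1 ⟩
      u i + - (u i * 1#)            ≡⟨ solve 1 (λ uᵢ → uᵢ :+ :- (uᵢ :* con 1ℤ) := con 0ℤ) refl (u i) ⟩
      0#                            ∎
    x≋Xvu′ : x ≋ X v u′
    x≋Xvu′ = ≋-trans x≋Xvu (≋-sym (X-shift v u _))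
    v∈⟨v,_⟩ : ∀ w → Span (λ y → y ≋ v ⊎ y ≋ w) v
    v∈⟨v,_⟩ w = S⊆Span (inj₁ (λ _ → refl))
    by-cases : Dec (∀ l → u′ l ≡ 0#) → P v x
    by-cases (yes u′≋0) = v , e j , LinIndep₂-pivot vᵢ≢0 (e-off-diagonal j≢i) eⱼⱼ≢0 , v∈⟨v, e j ⟩ ,
                          [] , [] , ≋-trans x≋Xvu′ (≋-trans (X-cong (λ _ → refl) u′≋0) (Linear.map-0v (X-linear v)))
      where
      j = punchIn i zero
      j≢i = punchInᵢ≢i i zero
      eⱼⱼ≢0 : e j j ≢ 0#
      eⱼⱼ≢0 eⱼⱼ≡0 = 0≢1 (trans (sym eⱼⱼ≡0) (e-diagonal j))
    by-cases (no u′≢0) with nonzero-coordinate u′≢0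
    ... | l , u′ₗ≢0 = v , u′ , LinIndep₂-pivot vᵢ≢0 u′ᵢ≡0 u′ₗ≢0 , v∈⟨v, u′ ⟩ , S⊆Span x≋Xvu′

  P≐Image-X : ∀ {m} {v : Vec (Fin (suc (suc m)))} → NonZero v → P v ≐ Image (X v)
  P≐Image-X v≢0 x with nonzero-coordinate v≢0
  ... | i , vᵢ≢0 = mk⇔ (P⊆Image-X v≢0) (Image-X⊆P-pivot vᵢ≢0)

  join-cong : ∀ {k} {x x′ : Vec (Fin k)} {y y′ : Vec (Pair k)} → x ≋ x′ → y ≋ y′ → join x y ≋ join x′ y′
  join-cong x≋x′ y≋y′ (zero , suc j , _)       = x≋x′ j
  join-cong x≋x′ y≋y′ (suc s , suc t , s≤s s<t) = y≋y′ (s , t , s<t)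

  join-linear : ∀ {J k} {f : Vec J → Vec (Fin k)} {g : Vec J → Vec (Pair k)} →
                Linear f → Linear g → Linear (λ x → join (f x) (g x))
  join-linear lin-f lin-g = record
    { cong-≋   = λ x≋y → join-cong (Lf.cong-≋ x≋y) (Lg.cong-≋ x≋y)
    ; map-0v   = ≋-trans (join-cong Lf.map-0v Lg.map-0v) join-0v
    ; map-comb = λ c x y → ≋-trans (join-cong (Lf.map-comb c x y) (Lg.map-comb c x y)) join-comb
    }
    where
    module Lf = Linear lin-f
    module Lg = Linear lin-g
    join-0v : ∀ {k} → join {k} 0v 0v ≋ 0v
    join-0v (zero , suc j , _)       = refl
    join-0v (suc s , suc t , s≤s _)  = refl
    join-comb : ∀ {k c} {x x′ : Vec (Fin k)} {y y′ : Vec (Pair k)} →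
                join ((c • x) ⊕ x′) ((c • y) ⊕ y′) ≋ (c • join x y) ⊕ join x′ y′
    join-comb (zero , suc j , _)       = refl
    join-comb (suc s , suc t , s≤s _)  = refl

  X-∷ : ∀ {k} (v u : Vec (Fin (suc k))) →
        X v u ≋ join ((head v • tail u) ⊕ ((- head u) • tail v)) (X (tail v) (tail u))
  X-∷ v u (zero , suc j , _) =
    solve 4 (λ v₀ u₀ vⱼ uⱼ → v₀ :* uⱼ :+ :- (vⱼ :* u₀) := v₀ :* uⱼ :+ (:- u₀) :* vⱼ)
      refl (v zero) (u zero) (v (suc j)) (u (suc j))
  X-∷ v u (suc s , suc t , s≤s _) = refl

  graphX : ∀ {k} → Carrier → Vec (Fin k) → Vec (Fin k) → Vec (Pair (suc k))
  graphX a v̂ x = join x (a • X v̂ x)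

  U-a≐Image-graphX : ∀ {k} (v̂ : Vec (Fin k)) a → U-a v̂ a ≐ Image (graphX a v̂)
  U-a≐Image-graphX v̂ a = Span-basis-image≐Image (join-linear id-linear (•-linear a (X-linear v̂)))

  Image-graphX≐U₀ : ∀ {k} {v̂ : Vec (Fin k)} a → v̂ ≋ 0v → Image (graphX a v̂) ≐ U₀
  Image-graphX≐U₀ {v̂ = v̂} a v̂≋0 z = mk⇔
    (λ (x , z≋) → x , ≋-trans z≋ (join-cong (λ _ → refl) (aX≋0 x)))
    (λ (x , z≋) → x , ≋-trans z≋ (join-cong (λ _ → refl) (≋-sym (aX≋0 x))))
    where
    aX≋0 : ∀ x → a • X v̂ x ≋ 0v
    aX≋0 x p = trans (cong (a *_) (X-zeroˡ {u = x} v̂≋0 p)) (zeroʳ a)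

  Image-X≐Image-graphX : ∀ {k} (v : Vec (Fin (suc k))) {a} → head v * a ≡ 1# →
                         Image (X v) ≐ Image (graphX a (tail v))
  Image-X≐Image-graphX v {a} v₀a≡1 z = mk⇔ to from
    where
    v₀ = head v
    v̂ = tail v
    to : Image (X v) z → Image (graphX a v̂) z
    to (u , z≋Xvu) = y , ≋-trans z≋Xvu (≋-trans (X-∷ v u) (join-cong (λ _ → refl) X̂≋))
      where
      y = (v₀ • tail u) ⊕ ((- head u) • v̂)
      X̂≋ : X v̂ (tail u) ≋ a • X v̂ y
      X̂≋ p = begin
        X v̂ (tail u) p               ≡⟨ sym (cancel-inverse (trans (*-comm a v₀) v₀a≡1) _) ⟩
        a * (v₀ * X v̂ (tail u) p)   ≡⟨ cong (a *_) (sym (X-•ʳ v̂ (tail u) v₀ p)) ⟩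
        a * X v̂ (v₀ • tail u) p     ≡⟨ cong (a *_) (sym (X-shift v̂ (v₀ • tail u) (- head u) p)) ⟩
        a * X v̂ y p                  ∎
    from : Image (graphX a v̂) z → Image (X v) z
    from (x , z≋graph) = 0# ∷ᵛ (a • x) , ≋-trans z≋graph (≋-sym (≋-trans (X-∷ v (0# ∷ᵛ (a • x)))
                           (join-cong x≋ (X-•ʳ v̂ x a))))
      where
      x≋ : (v₀ • (a • x)) ⊕ ((- 0#) • v̂) ≋ x
      x≋ j = begin
        v₀ * (a * x j) + - 0# * v̂ j  ≡⟨ solve 2 (λ p vⱼ → p :+ :- con 0ℤ :* vⱼ := p) refl _ (v̂ j) ⟩
        v₀ * (a * x j)               ≡⟨ cancel-inverse v₀a≡1 (x j) ⟩
        x j                          ∎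

  join-as-lincomb : ∀ {k} c (x : Vec (Fin k)) (y : Vec (Pair k)) →
                    join (c • x) y ≋ lincomb ((c , join x 0v) ∷ (1# , join 0v y) ∷ [])
  join-as-lincomb c x y (zero , suc j , _) =
    solve 2 (λ c xⱼ → c :* xⱼ := c :* xⱼ :+ (con 1ℤ :* con 0ℤ :+ con 0ℤ)) refl c (x j)
  join-as-lincomb c x y p@(suc s , suc t , s≤s _) =
    solve 2 (λ c yₚ → yₚ := c :* con 0ℤ :+ (con 1ℤ :* yₚ :+ con 0ℤ)) refl c (join x y p)

  Image-X≐U-0 : ∀ {k} (v : Vec (Fin (suc (suc (suc k))))) → head v ≡ 0# → NonZero (tail v) →
                Image (X v) ≐ U-0 (tail v)
  Image-X≐U-0 v v₀≡0 v̂≢0 z = mk⇔ to from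
    where
    v̂ = tail v
    X≋ : ∀ u → X v u ≋ join ((- head u) • v̂) (X v̂ (tail u))
    X≋ u = ≋-trans (X-∷ v u) (join-cong first (λ _ → refl))
      where
      first : (head v • tail u) ⊕ ((- head u) • v̂) ≋ (- head u) • v̂
      first j = begin
        head v * u (suc j) + - head u * v̂ j  ≡⟨ cong (λ c → c * u (suc j) + - head u * v̂ j) v₀≡0 ⟩
        0# * u (suc j) + - head u * v̂ j      ≡⟨ solve 2 (λ uⱼ q → con 0ℤ :* uⱼ :+ q := q) refl (u (suc j)) _ ⟩
        - head u * v̂ j                        ∎
    to : Image (X v) z → U-0 v̂ z
    to (u , z≋Xvu) =
      (- head u , join v̂ 0v) ∷ (1# , join 0v (X v̂ (tail u))) ∷ [] ,
      inj₁ (λ _ → refl) ∷ inj₂ (X v̂ (tail u) , Equivalence.from (P≐Image-X v̂≢0 _) (tail u , λ _ → refl) , λ _ → refl) ∷ [] ,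
      ≋-trans z≋Xvu (≋-trans (X≋ u) (join-as-lincomb (- head u) v̂ (X v̂ (tail u))))
    generator∈Image : (λ y → y ≋ join v̂ 0v ⊎ ∃[ w ] (P v̂ w × y ≋ join 0v w)) ⊆ Image (X v)
    generator∈Image (inj₁ y≋) = (- 1#) ∷ᵛ 0v , ≋-trans y≋ (≋-sym (≋-trans (X≋ ((- 1#) ∷ᵛ 0v))
      (join-cong (λ j → solve 1 (λ vⱼ → :- (:- con 1ℤ) :* vⱼ := vⱼ) refl (v̂ j)) (Linear.map-0v (X-linear v̂)))))
    generator∈Image (inj₂ (w , w∈P , y≋)) with Equivalence.to (P≐Image-X v̂≢0 w) w∈P
    ... | û , w≋X̂û = 0# ∷ᵛ û , ≋-trans y≋ (≋-sym (≋-trans (X≋ (0# ∷ᵛ û))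
      (join-cong (λ j → solve 1 (λ vⱼ → :- con 0ℤ :* vⱼ := con 0ℤ) refl (v̂ j)) (≋-sym w≋X̂û))))
    from : U-0 v̂ z → Image (X v) z
    from = Span⊆Image (X-linear v) generator∈Image

  Inℂ-of-Image-X : ∀ {k} {S : Subset F (Pair (suc (suc k)))} (v : Vec (Fin (suc (suc k)))) →
                   NonZero v → S ≐ Image (X v) → Inℂ F S
  Inℂ-of-Image-X v v≢0 S≐ = v , v≢0 , ≐-trans S≐ (≐-sym (P≐Image-X v≢0))

  In𝔻⇒Inℂ : ∀ {k} {S : Subset F (Pair (suc (suc (suc k))))} → In𝔻 F S → Inℂ F S
  In𝔻⇒Inℂ (inj₁ S≐U₀) = Inℂ-of-Image-X (1# ∷ᵛ 0v) (λ v≋0 → 0≢1 (sym (v≋0 zero)))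
    (≐-trans S≐U₀ (≐-sym (≐-trans (Image-X≐Image-graphX (1# ∷ᵛ 0v) (*-identityˡ 1#))
                                   (Image-graphX≐U₀ 1# (λ _ → refl)))))
  In𝔻⇒Inℂ (inj₂ (inj₁ (v̂ , v̂≢0 , S≐U-0))) = Inℂ-of-Image-X (0# ∷ᵛ v̂) (λ v≋0 → v̂≢0 (v≋0 ∘ suc))
    (≐-trans S≐U-0 (≐-sym (Image-X≐U-0 (0# ∷ᵛ v̂) refl v̂≢0)))
  In𝔻⇒Inℂ (inj₂ (inj₂ (v̂ , a , v̂≢0 , a≢0 , S≐U-a))) with inverse a a≢0
  ... | a⁻¹ , aa⁻¹≡1 = Inℂ-of-Image-X (a⁻¹ ∷ᵛ v̂) (λ v≋0 → v̂≢0 (v≋0 ∘ suc))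
    (≐-trans S≐U-a (≐-trans (U-a≐Image-graphX v̂ a)
                            (≐-sym (Image-X≐Image-graphX (a⁻¹ ∷ᵛ v̂) (trans (*-comm a⁻¹ a) aa⁻¹≡1)))))

  In𝔻-of-Image-X : ∀ {k} {S : Subset F (Pair (suc (suc (suc k))))} (v : Vec (Fin (suc (suc (suc k))))) →
                   NonZero v → S ≐ Image (X v) → In𝔻 F S
  In𝔻-of-Image-X v v≢0 S≐Image with head v ≟ 0#
  ... | yes v₀≡0 = inj₂ (inj₁ (tail v , v̂≢0 , ≐-trans S≐Image (Image-X≐U-0 v v₀≡0 v̂≢0)))
    where
    v̂≢0 : NonZero (tail v)
    v̂≢0 v̂≋0 = v≢0 λ { zero → v₀≡0 ; (suc j) → v̂≋0 j }
  ... | no v₀≢0 with inverse (head v) v₀≢0 | all? (λ j → tail v j ≟ 0#)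
  ...   | a , v₀a≡1 | yes v̂≋0 =
    inj₁ (≐-trans S≐Image (≐-trans (Image-X≐Image-graphX v v₀a≡1) (Image-graphX≐U₀ a v̂≋0)))
  ...   | a , v₀a≡1 | no v̂≢0 =
    inj₂ (inj₂ (tail v , a , v̂≢0 , a≢0 ,
      ≐-trans S≐Image (≐-trans (Image-X≐Image-graphX v v₀a≡1) (≐-sym (U-a≐Image-graphX (tail v) a)))))
    where
    a≢0 : a ≢ 0#
    a≢0 a≡0 = 0≢1 (trans (sym (zeroʳ (head v))) (trans (cong (head v *_) (sym a≡0)) v₀a≡1))

  Inℂ⇒In𝔻 : ∀ {k} {S : Subset F (Pair (suc (suc (suc k))))} → Inℂ F S → In𝔻 F S
  Inℂ⇒In𝔻 (v , v≢0 , S≐P) = In𝔻-of-Image-X v v≢0 (≐-trans S≐P (P≐Image-X v≢0))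

theorem17 : (F : FiniteField) (k : ℕ) → 3 ≤ suc k →
    (S : Subset F (Pair (suc k))) → In𝔻 F S ⇔ Inℂ F S
theorem17 F (suc (suc k)) (s≤s (s≤s (s≤s z≤n))) S = mk⇔ (Plücker.In𝔻⇒Inℂ F) (Plücker.Inℂ⇒In𝔻 F)
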